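{- For the infinite square grid $SQ$, the minimum density of a RED:LD set satisfies $\frac{2}{5} \le \textrm{RED:LD}\%(SQ) \le \frac{7}{16}$.
   Context: $SQ$ is the infinite 4-regular square grid graph (the Cartesian product of two two-way infinite paths). $N(v)$ denotes the open neighborhood of $v$. A set $S \subseteq V(G)$ is a locating-dominating (LD) set if for all $u,v \in V(G)-S$: $N(v)\cap S \neq \varnothing$, and if $u \ne v$ then $N(v) \cap S \neq N(u) \cap S$. A RED:LD set is an LD set $S$ such that $S-\{v\}$ is an LD set for every $v \in S$. For an infinite graph, the density of $S$ is the ratio of the number of detectors to the number of vertices (in the usual limiting sense), and $\textrm{RED:LD}\%(G)$ is the minimum density of a RED:LD set. -}

module Defs where

open import Data.Nat as ℕ using (ℕ; suc; _≤_)
open import Data.Integer as ℤ using (ℤ; +_; ∣_∣)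
open import Data.Bool using (Bool; true; false; T)
open import Data.Product using (_×_; _,_; Σ; ∃)
open import Data.List using (List; map; upTo; concatMap)
open import Data.Nat.ListAction using (sum)
open import Relation.Binary.PropositionalEquality using (_≡_; _≢_)
open import Relation.Nullary using (¬_)
open import Function.Bundles using (_⇔_)

V : Set
V = ℤ × ℤ

Adj : V → V → Set
Adj (a , b) (c , d) = ∣ a ℤ.- c ∣ ℕ.+ ∣ b ℤ.- d ∣ ≡ 1

VSet : Set₁
VSet = V → Set

InNbrS : VSet → V → V → Set
InNbrS S v w = Adj v w × S w

IsLD : VSet → Set
IsLD S =
  (∀ v → ¬ S v → ∃ λ w → InNbrS S v w)
  × (∀ u v → ¬ S u → ¬ S v → u ≢ v →
       ¬ (∀ w → (InNbrS S u w ⇔ InNbrS S v w)))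

remove : VSet → V → VSet
remove S v w = S w × w ≢ v

IsREDLD : VSet → Set
IsREDLD S = IsLD S × (∀ v → S v → IsLD (remove S v))

-- Decidable subsets (needed for counting).
toSet : (V → Bool) → VSet
toSet S w = T (S w)

range : ℕ → List ℤ
range n = map (λ k → (+ k) ℤ.- (+ n)) (upTo (suc (n ℕ.+ n)))

box : ℕ → List V
box n = concatMap (λ i → map (λ j → (i , j)) (range n)) (range n)

indic : Bool → ℕ
indic true = 1
indic false = 0

count : (V → Bool) → ℕ → ℕ
count S n = sum (map (λ w → indic (S w)) (box n))

boxSize : ℕ → ℕ
boxSize n = suc (n ℕ.+ n) ℕ.* suc (n ℕ.+ n)

-- Density (limsup of count/boxSize) is ≥ p/q:
-- ∀ k ≥ 1, ∀ N, ∃ n ≥ N, count/size ≥ p/q − 1/k,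
-- i.e. q·k·count + q·size ≥ p·k·size.
DensityGE : (V → Bool) → ℕ → ℕ → Set
DensityGE S p q = ∀ k → 1 ≤ k → ∀ N → ∃ λ n → N ≤ n ×
  (p ℕ.* k ℕ.* boxSize n ≤ q ℕ.* k ℕ.* count S n ℕ.+ q ℕ.* boxSize n)

-- Density (limsup of count/boxSize) is ≤ p/q:
-- ∀ k ≥ 1, ∃ N, ∀ n ≥ N, count/size ≤ p/q + 1/k,
-- i.e. q·k·count ≤ p·k·size + q·size.
DensityLE : (V → Bool) → ℕ → ℕ → Set
DensityLE S p q = ∀ k → 1 ≤ k → ∃ λ N → ∀ n → N ≤ n →
  (q ℕ.* k ℕ.* count S n ≤ p ℕ.* k ℕ.* boxSize n ℕ.+ q ℕ.* boxSize n)

-- Lower bound: in a RED:LD set S every vertex outside S has two neighbours in S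
-- (delete one dominator and it must still be dominated) and every vertex of S has
-- one (delete the vertex itself). Counting the edges between S and its complement
-- in a box from both ends gives 2·|box ∖ S| ≤ 3·|box ∩ S| up to a boundary term
-- linear in the side, hence density ≥ 2/5.
--
-- Upper bound: a periodic set with 14 detectors in each 4 × 8 tile. Being RED:LD
-- is local: besides the two domination conditions, two non-detectors of S ∖ {x}
-- with equal traces are at distance two (they share a dominator), so it suffices
-- that every such pair is separated by a detector surviving the deletion of one
-- vertex. This is decided by evaluation on the 32 residue classes, and summing
-- over whole periods gives density 14/32 = 7/16.

module Submission where

open import Defs
open import Data.Bool using (Bool; true; false; T; not; _∧_; _∨_; _xor_)
open import Data.Bool.ListAction using (any; all)
open import Data.Bool.Properties using (T-∧; T-∨; ∧-identityʳ; ∧-zeroʳ)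
open import Data.Empty using (⊥-elim)
open import Data.Integer as ℤ using (ℤ; +_; -[1+_]; ∣_∣)
import Data.Integer.Properties as ℤP
open import Data.Integer.Solver using (module +-*-Solver)
open import Data.List using (List; []; _∷_; _++_; map; applyUpTo; upTo; concatMap; cartesianProductWith; findᵇ)
open import Data.List.Membership.Propositional using (_∈_)
open import Data.List.Membership.Propositional.Properties using (∈-cartesianProductWith⁺)
open import Data.List.Relation.Unary.All as All using (All; []; _∷_)
open import Data.List.Relation.Unary.All.Properties using (all⁺)
open import Data.List.Relation.Unary.Any using (here; there; satisfied)
open import Data.List.Relation.Unary.Any.Properties using (any⁻)
open import Data.Maybe using (Maybe; just; nothing)
open import Data.Nat as ℕ using (ℕ; zero; suc; _+_; _*_; _≤_; z≤n; s≤s; NonZero)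
import Data.Nat.Properties as ℕP
open import Algebra.Properties.CommutativeSemigroup ℕP.+-commutativeSemigroup
  using () renaming (interchange to +-interchange)
open import Data.Nat.Solver renaming (module +-*-Solver to ℕ-Solver)
open import Data.Nat.DivMod using (_/_; _%_; m≡m%n+[m/n]*n; m%n<n)
open import Data.Nat.ListAction using (sum)
open import Data.Nat.ListAction.Properties using (sum-++)
import Data.List.Properties as ListP
open import Data.Product using (_×_; _,_; proj₁; proj₂; Σ; ∃)
open import Data.Product.Properties using (≡-dec)
open import Data.Sum using (_⊎_; inj₁; inj₂)
open import Data.Unit using (tt)
open import Function using (_∘_; _⇔_; Equivalence)
open import Relation.Binary.PropositionalEquality
open import Relation.Nullary using (¬_; Dec; yes; no)
open import Relation.Nullary.Decidable using (⌊_⌋; toWitness; toWitnessFalse; T?; ¬?; _×-dec_)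

infixl 6 _⊕_

_⊕_ : V → V → V
(a , b) ⊕ (c , d) = (a ℤ.+ c , b ℤ.+ d)

origin : V
origin = (+ 0 , + 0)

⊕-assoc : ∀ u a b → (u ⊕ a) ⊕ b ≡ u ⊕ (a ⊕ b)
⊕-assoc (i , j) (a , b) (c , d) = cong₂ _,_ (ℤP.+-assoc i a c) (ℤP.+-assoc j b d)

⊕-identityʳ : ∀ u → u ⊕ origin ≡ u
⊕-identityʳ (i , j) = cong₂ _,_ (ℤP.+-identityʳ i) (ℤP.+-identityʳ j)

module ℤ-Identities where
  open +-*-Solver

  cancelˡ : ∀ i a → a ≡ ℤ.- i ℤ.+ (i ℤ.+ a)
  cancelˡ = solve 2 (λ i a → a := :- i :+ (i :+ a)) refl

  [i+a]-[i+c] : ∀ i a c → (i ℤ.+ a) ℤ.- (i ℤ.+ c) ≡ a ℤ.- c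
  [i+a]-[i+c] = solve 3 (λ i a c → (i :+ a) :- (i :+ c) := a :- c) refl

  c≡a+[c-a] : ∀ a c → c ≡ a ℤ.+ (c ℤ.- a)
  c≡a+[c-a] = solve 2 (λ a c → c := a :+ (c :- a)) refl

  suc-+ : ∀ k z → + suc k ℤ.+ z ≡ (+ k ℤ.+ z) ℤ.+ + 1
  suc-+ k = solve 2 (λ k z → (con (+ 1) :+ k) :+ z := (k :+ z) :+ con (+ 1)) refl (+ k)

  suc-+-pred : ∀ k z → (+ suc k ℤ.+ z) ℤ.+ -[1+ 0 ] ≡ + k ℤ.+ z
  suc-+-pred k = solve 2 (λ k z → ((con (+ 1) :+ k) :+ z) :+ con -[1+ 0 ] := k :+ z) refl (+ k)

open ℤ-Identities

⊕-cancelˡ : ∀ u {a b} → u ⊕ a ≡ u ⊕ b → a ≡ b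
⊕-cancelˡ (i , j) {a , b} {c , d} eq = cong₂ _,_ (cancel i a c (cong proj₁ eq)) (cancel j b d (cong proj₂ eq))
  where
  cancel : ∀ i a c → i ℤ.+ a ≡ i ℤ.+ c → a ≡ c
  cancel i a c e = trans (cancelˡ i a) (trans (cong (λ z → ℤ.- i ℤ.+ z) e) (sym (cancelˡ i c)))

data Dir : Set where
  east west north south : Dir

dir : Dir → V
dir east  = (+ 1 , + 0)
dir west  = (-[1+ 0 ] , + 0)
dir north = (+ 0 , + 1)
dir south = (+ 0 , -[1+ 0 ])

opposite : Dir → Dir
opposite east  = west
opposite west  = east
opposite north = south
opposite south = north

dir-opposite : ∀ d → dir (opposite d) ⊕ dir d ≡ origin
dir-opposite east  = refl
dir-opposite west  = refl
dir-opposite north = refl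
dir-opposite south = refl

allDirs : List Dir
allDirs = east ∷ west ∷ north ∷ south ∷ []

∈-allDirs : ∀ d → d ∈ allDirs
∈-allDirs east  = here refl
∈-allDirs west  = there (here refl)
∈-allDirs north = there (there (here refl))
∈-allDirs south = there (there (there (here refl)))

Adj-⊕ : ∀ u a b → Adj (u ⊕ a) (u ⊕ b) ≡ Adj a b
Adj-⊕ (i , j) (a , b) (c , d) rewrite [i+a]-[i+c] i a c | [i+a]-[i+c] j b d = refl

Adj-⊕⁺ : ∀ u {a b} → Adj a b → Adj (u ⊕ a) (u ⊕ b)
Adj-⊕⁺ u {a} {b} = subst (λ P → P) (sym (Adj-⊕ u a b))

Adj-⊕⁻ : ∀ u {a b} → Adj (u ⊕ a) (u ⊕ b) → Adj a b
Adj-⊕⁻ u {a} {b} = subst (λ P → P) (Adj-⊕ u a b)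

Adj-from-origin : ∀ u {o} → Adj origin o → Adj u (u ⊕ o)
Adj-from-origin u {o} a = subst (λ x → Adj x (u ⊕ o)) (⊕-identityʳ u) (Adj-⊕⁺ u a)

Adj-sym : ∀ u w → Adj u w → Adj w u
Adj-sym (a , b) (c , d) p rewrite ℤP.∣i-j∣≡∣j-i∣ c a | ℤP.∣i-j∣≡∣j-i∣ d b = p

unit-vector : ∀ x y → ∣ x ∣ + ∣ y ∣ ≡ 1 → ∃ λ d → dir d ≡ (x , y)
unit-vector (+ 0)           (+ 0)           ()
unit-vector (+ 0)           (+ 1)           refl = north , refl
unit-vector (+ 0)           (+ suc (suc _)) ()
unit-vector (+ 0)           -[1+ 0 ]        refl = south , refl
unit-vector (+ 0)           -[1+ suc _ ]    ()
unit-vector (+ 1)           (+ 0)           refl = east , refl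
unit-vector (+ 1)           (+ suc _)       ()
unit-vector (+ 1)           -[1+ _ ]        ()
unit-vector (+ suc (suc _)) _               ()
unit-vector -[1+ 0 ]        (+ 0)           refl = west , refl
unit-vector -[1+ 0 ]        (+ suc _)       ()
unit-vector -[1+ 0 ]        -[1+ _ ]        ()
unit-vector -[1+ suc _ ]    _               ()

Adj⇒dir : ∀ u w → Adj u w → ∃ λ d → w ≡ u ⊕ dir d
Adj⇒dir (a , b) (c , d) p with unit-vector (c ℤ.- a) (d ℤ.- b) (Adj-sym (a , b) (c , d) p)
... | δ , e = δ , cong₂ _,_ (trans (c≡a+[c-a] a c) (cong (λ z → a ℤ.+ z) (sym (cong proj₁ e))))
                            (trans (c≡a+[c-a] b d) (cong (λ z → b ℤ.+ z) (sym (cong proj₂ e))))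

Adj? : ∀ u w → Dec (Adj u w)
Adj? (a , b) (c , d) = (∣ a ℤ.- c ∣ + ∣ b ℤ.- d ∣) ℕ.≟ 1

_≟ᵥ_ : (u w : V) → Dec (u ≡ w)
_≟ᵥ_ = ≡-dec ℤ._≟_ ℤ._≟_

sumOver : {A : Set} → List A → (A → ℕ) → ℕ
sumOver xs f = sum (map f xs)

syntax sumOver xs (λ x → e) = ∑[ x ∈ xs ] e

indic-T : ∀ {b} → T b → indic b ≡ 1
indic-T {true} _ = refl

indic≤1 : ∀ b → indic b ≤ 1
indic≤1 true  = ℕP.≤-refl
indic≤1 false = z≤n

indic-not+indic : ∀ b → indic (not b) + indic b ≡ 1
indic-not+indic true  = refl
indic-not+indic false = refl

module _ {A : Set} where

  ∑-cong : ∀ (xs : List A) {f g : A → ℕ} → (∀ x → f x ≡ g x) → ∑[ x ∈ xs ] f x ≡ ∑[ x ∈ xs ] g x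
  ∑-cong []       f≗g = refl
  ∑-cong (x ∷ xs) f≗g = cong₂ _+_ (f≗g x) (∑-cong xs f≗g)

  ∑-mono : ∀ (xs : List A) {f g : A → ℕ} → (∀ x → f x ≤ g x) → ∑[ x ∈ xs ] f x ≤ ∑[ x ∈ xs ] g x
  ∑-mono []       f≤g = z≤n
  ∑-mono (x ∷ xs) f≤g = ℕP.+-mono-≤ (f≤g x) (∑-mono xs f≤g)

  ∑-distrib-+ : ∀ (xs : List A) (f g : A → ℕ) → ∑[ x ∈ xs ] (f x + g x) ≡ ∑[ x ∈ xs ] f x + ∑[ x ∈ xs ] g x
  ∑-distrib-+ []       f g = refl
  ∑-distrib-+ (x ∷ xs) f g rewrite ∑-distrib-+ xs f g = +-interchange (f x) (g x) _ _

  *-distribˡ-∑ : ∀ (xs : List A) c (f : A → ℕ) → c * ∑[ x ∈ xs ] f x ≡ ∑[ x ∈ xs ] (c * f x)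
  *-distribˡ-∑ []       c f = ℕP.*-zeroʳ c
  *-distribˡ-∑ (x ∷ xs) c f = trans (ℕP.*-distribˡ-+ c (f x) _) (cong (_+_ (c * f x)) (*-distribˡ-∑ xs c f))

  ∑-comm : ∀ {B : Set} (xs : List B) (ys : List A) (f : B → A → ℕ) →
           ∑[ x ∈ xs ] ∑[ y ∈ ys ] f x y ≡ ∑[ y ∈ ys ] ∑[ x ∈ xs ] f x y
  ∑-comm []       ys f = sym (∑-zero ys)
    where
    ∑-zero : (ys : List A) → ∑[ y ∈ ys ] 0 ≡ 0
    ∑-zero []       = refl
    ∑-zero (_ ∷ ys) = ∑-zero ys
  ∑-comm (x ∷ xs) ys f = trans (cong (_+_ (∑[ y ∈ ys ] f x y)) (∑-comm xs ys f))
                              (sym (∑-distrib-+ ys (f x) (λ y → ∑[ x ∈ xs ] f x y)))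

  ∑-map : ∀ {B : Set} (xs : List B) (g : B → A) (f : A → ℕ) → ∑[ x ∈ map g xs ] f x ≡ ∑[ y ∈ xs ] f (g y)
  ∑-map []       g f = refl
  ∑-map (y ∷ xs) g f = cong (_+_ (f (g y))) (∑-map xs g f)

  ∑-concatMap : ∀ {B : Set} (ys : List B) (h : B → List A) (f : A → ℕ) →
                ∑[ x ∈ concatMap h ys ] f x ≡ ∑[ y ∈ ys ] ∑[ x ∈ h y ] f x
  ∑-concatMap []       h f = refl
  ∑-concatMap (y ∷ ys) h f =
    trans (cong sum (ListP.map-++ f (h y) (concatMap h ys)))
          (trans (sum-++ (map f (h y)) _) (cong (_+_ (∑[ x ∈ h y ] f x)) (∑-concatMap ys h f)))

  ∑-indic-not : ∀ (xs : List A) (p : A → Bool) →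
                ∑[ x ∈ xs ] indic (not (p x)) + ∑[ x ∈ xs ] indic (p x) ≡ ∑[ x ∈ xs ] 1
  ∑-indic-not xs p = trans (sym (∑-distrib-+ xs _ _)) (∑-cong xs (λ x → indic-not+indic (p x)))

  1≤∑-indic : ∀ {xs : List A} {x} (p : A → Bool) → x ∈ xs → T (p x) → 1 ≤ ∑[ y ∈ xs ] indic (p y)
  1≤∑-indic p (here refl) px rewrite indic-T px = s≤s z≤n
  1≤∑-indic p (there x∈xs) px = ℕP.≤-trans (1≤∑-indic p x∈xs px) (ℕP.m≤n+m _ _)

  2≤∑-indic : ∀ {xs : List A} {x y} (p : A → Bool) → x ∈ xs → y ∈ xs → x ≢ y → T (p x) → T (p y) →
                2 ≤ ∑[ z ∈ xs ] indic (p z)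
  2≤∑-indic p (here refl)  (here refl)  x≢y px py = ⊥-elim (x≢y refl)
  2≤∑-indic p (here refl)  (there y∈xs) x≢y px py rewrite indic-T px = s≤s (1≤∑-indic p y∈xs py)
  2≤∑-indic p (there x∈xs) (here refl)  x≢y px py rewrite indic-T py = s≤s (1≤∑-indic p x∈xs px)
  2≤∑-indic p (there x∈xs) (there y∈xs) x≢y px py =
    ℕP.≤-trans (2≤∑-indic p x∈xs y∈xs x≢y px py) (ℕP.m≤n+m _ _)

∑< : ℕ → (ℕ → ℕ) → ℕ
∑< zero    h = 0
∑< (suc m) h = h 0 + ∑< m (h ∘ suc)

∑<-cong : ∀ m {h g : ℕ → ℕ} → (∀ k → h k ≡ g k) → ∑< m h ≡ ∑< m g
∑<-cong zero    h≗g = refl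
∑<-cong (suc m) h≗g = cong₂ _+_ (h≗g 0) (∑<-cong m (h≗g ∘ suc))

∑<-bound : ∀ m {c} (h : ℕ → ℕ) → (∀ k → h k ≤ c) → ∑< m h ≤ m * c
∑<-bound zero    h h≤c = z≤n
∑<-bound (suc m) h h≤c = ℕP.+-mono-≤ (h≤c 0) (∑<-bound m (h ∘ suc) (h≤c ∘ suc))

∑<-const : ∀ m c → ∑< m (λ _ → c) ≡ m * c
∑<-const zero    c = refl
∑<-const (suc m) c = cong (_+_ c) (∑<-const m c)

∑<-snoc : ∀ m (h : ℕ → ℕ) → ∑< (suc m) h ≡ ∑< m h + h m
∑<-snoc zero    h = ℕP.+-comm (h 0) 0
∑<-snoc (suc m) h = trans (cong (_+_ (h 0)) (∑<-snoc m (h ∘ suc))) (sym (ℕP.+-assoc (h 0) _ _))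

∑<-+ : ∀ m ℓ (h : ℕ → ℕ) → ∑< (m + ℓ) h ≡ ∑< m h + ∑< ℓ (λ k → h (m + k))
∑<-+ zero    ℓ h = refl
∑<-+ (suc m) ℓ h = trans (cong (_+_ (h 0)) (∑<-+ m ℓ (h ∘ suc))) (sym (ℕP.+-assoc (h 0) _ _))

∑-applyUpTo : ∀ {A : Set} m (g : ℕ → A) (f : A → ℕ) → ∑[ x ∈ applyUpTo g m ] f x ≡ ∑< m (f ∘ g)
∑-applyUpTo zero    g f = refl
∑-applyUpTo (suc m) g f = cong (_+_ (f (g 0))) (∑-applyUpTo m (g ∘ suc) f)

∑<-shiftˡ : ∀ m {c} (h : ℕ → ℕ) → (∀ k → h k ≤ c) → ∑< m h ≤ ∑< m (h ∘ suc) + c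
∑<-shiftˡ zero    h h≤c = z≤n
∑<-shiftˡ (suc m) {c} h h≤c = begin
  h 0 + ∑< m (h ∘ suc)                   ≤⟨ ℕP.+-monoˡ-≤ _ (h≤c 0) ⟩
  c + ∑< m (h ∘ suc)                     ≤⟨ ℕP.+-monoʳ-≤ c (ℕP.m≤m+n _ _) ⟩
  c + (∑< m (h ∘ suc) + h (suc m))       ≡⟨ cong (_+_ c) (sym (∑<-snoc m (h ∘ suc))) ⟩
  c + ∑< (suc m) (h ∘ suc)               ≡⟨ ℕP.+-comm c _ ⟩
  ∑< (suc m) (h ∘ suc) + c               ∎
  where open ℕP.≤-Reasoning

∑<-shiftʳ : ∀ m {c} (h : ℕ → ℕ) → (∀ k → h k ≤ c) → ∑< m (h ∘ suc) ≤ ∑< m h + c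
∑<-shiftʳ m {c} h h≤c = begin
  ∑< m (h ∘ suc)        ≤⟨ ℕP.m≤n+m _ (h 0) ⟩
  ∑< (suc m) h          ≡⟨ ∑<-snoc m h ⟩
  ∑< m h + h m          ≤⟨ ℕP.+-monoʳ-≤ _ (h≤c m) ⟩
  ∑< m h + c            ∎
  where open ℕP.≤-Reasoning

-- Splitting ℓ = q·p + r into q full periods and a remainder of r < p terms.
∑<-periodic : ∀ p .{{_ : NonZero p}} {W c} (h : ℕ → ℕ) → (∀ k → h k ≤ c) →
              (∀ m → ∑< p (λ k → h (m + k)) ≡ W) → ∀ ℓ → p * ∑< ℓ h ≤ ℓ * W + p * p * c
∑<-periodic p {W} {c} h h≤c period ℓ = begin
  p * ∑< ℓ h                                        ≡⟨ cong (λ t → p * ∑< t h) ℓ≡qp+r ⟩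
  p * ∑< (q * p + r) h                              ≡⟨ cong (p *_) (∑<-+ (q * p) r h) ⟩
  p * (∑< (q * p) h + ∑< r (λ k → h (q * p + k)))   ≤⟨ ℕP.*-monoʳ-≤ p (ℕP.+-mono-≤ (ℕP.≤-reflexive (periods q 0))
                                                                                (∑<-bound r _ (h≤c ∘ _+_ (q * p)))) ⟩
  p * (q * W + r * c)                               ≡⟨ solve 5 (λ p q r W c → p :* (q :* W :+ r :* c) := q :* p :* W :+ p :* (r :* c))
                                                             refl p q r W c ⟩
  q * p * W + p * (r * c)                           ≤⟨ ℕP.+-mono-≤ (ℕP.*-monoˡ-≤ W qp≤ℓ) (ℕP.*-monoʳ-≤ p (ℕP.*-monoˡ-≤ c (ℕP.<⇒≤ (m%n<n ℓ p)))) ⟩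
  ℓ * W + p * (p * c)                               ≡⟨ cong (_+_ (ℓ * W)) (sym (ℕP.*-assoc p p c)) ⟩
  ℓ * W + p * p * c                                 ∎
  where
  open ℕP.≤-Reasoning
  open ℕ-Solver
  q r : ℕ
  q = ℓ / p
  r = ℓ % p
  ℓ≡qp+r : ℓ ≡ q * p + r
  ℓ≡qp+r = trans (m≡m%n+[m/n]*n ℓ p) (ℕP.+-comm r (q * p))
  qp≤ℓ : q * p ≤ ℓ
  qp≤ℓ = subst (q * p ≤_) (sym ℓ≡qp+r) (ℕP.m≤m+n (q * p) r)
  periods : ∀ t m → ∑< (t * p) (λ k → h (m + k)) ≡ t * W
  periods zero    m = refl
  periods (suc t) m = begin-equality
    ∑< (p + t * p) (λ k → h (m + k))                              ≡⟨ ∑<-+ p (t * p) _ ⟩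
    ∑< p (λ k → h (m + k)) + ∑< (t * p) (λ k → h (m + (p + k)))   ≡⟨ cong₂ _+_ (period m)
                                                                      (∑<-cong (t * p) (λ k → cong h (sym (ℕP.+-assoc m p k)))) ⟩
    W + ∑< (t * p) (λ k → h (m + p + k))                          ≡⟨ cong (_+_ W) (periods t (m + p)) ⟩
    W + t * W                                                     ∎

side : ℕ → ℕ
side n = suc (n + n)

∑-range : ∀ n (f : ℤ → ℕ) → ∑[ x ∈ range n ] f x ≡ ∑< (side n) (λ k → f (+ k ℤ.- + n))
∑-range n f = trans (∑-map (upTo (side n)) _ f) (∑-applyUpTo (side n) (λ k → k) _)

n≤side : ∀ n → n ≤ side n
n≤side n = ℕP.≤-trans (ℕP.m≤m+n n n) (ℕP.n≤1+n _)

∑-range-const : ∀ n c → ∑[ x ∈ range n ] c ≡ side n * c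
∑-range-const n c = trans (∑-range n (λ _ → c)) (∑<-const (side n) c)

∑-range-bound : ∀ n {c} (f : ℤ → ℕ) → (∀ x → f x ≤ c) → ∑[ x ∈ range n ] f x ≤ side n * c
∑-range-bound n {c} f f≤c = subst (_≤ side n * c) (sym (∑-range n f)) (∑<-bound (side n) _ (λ k → f≤c (+ k ℤ.- + n)))

RangeShift : ℤ → Set
RangeShift a = ∀ n {c} (f : ℤ → ℕ) → (∀ x → f x ≤ c) → ∑[ x ∈ range n ] f x ≤ ∑[ x ∈ range n ] f (x ℤ.+ a) + c

∑-range-suc : RangeShift (+ 1)
∑-range-suc n {c} f f≤c
  rewrite ∑-range n f | ∑-range n (λ x → f (x ℤ.+ + 1)) =
  subst (λ t → ∑< (side n) (λ k → f (+ k ℤ.- + n)) ≤ t + c)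
        (∑<-cong (side n) (λ k → cong f (suc-+ k (ℤ.- + n))))
        (∑<-shiftˡ (side n) (λ k → f (+ k ℤ.- + n)) (λ k → f≤c (+ k ℤ.- + n)))

∑-range-pred : RangeShift -[1+ 0 ]
∑-range-pred n {c} f f≤c
  rewrite ∑-range n f | ∑-range n (λ x → f (x ℤ.+ -[1+ 0 ])) =
  subst (_≤ ∑< (side n) (λ k → f ((+ k ℤ.- + n) ℤ.+ -[1+ 0 ])) + c)
        (∑<-cong (side n) (λ k → cong f (suc-+-pred k (ℤ.- + n))))
        (∑<-shiftʳ (side n) (λ k → f ((+ k ℤ.- + n) ℤ.+ -[1+ 0 ])) (λ k → f≤c ((+ k ℤ.- + n) ℤ.+ -[1+ 0 ])))

∑-box : ∀ n (g : V → ℕ) → ∑[ u ∈ box n ] g u ≡ ∑[ i ∈ range n ] ∑[ j ∈ range n ] g (i , j)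
∑-box n g = trans (∑-concatMap (range n) (λ i → map (i ,_) (range n)) g) (∑-cong (range n) (λ i → ∑-map (range n) (i ,_) g))

module _ (n : ℕ) (g : V → ℕ) (g≤1 : ∀ u → g u ≤ 1) where
  open ℕP.≤-Reasoning

  private
    row≤side : ∀ i → ∑[ j ∈ range n ] g (i , j) ≤ side n * 1
    row≤side i = ∑-range-bound n (λ j → g (i , j)) (λ j → g≤1 (i , j))

    ∑-box-shiftˣ : ∀ {a} → RangeShift a → ∑[ u ∈ box n ] g u ≤ ∑[ u ∈ box n ] g (u ⊕ (a , + 0)) + side n
    ∑-box-shiftˣ {a} shift = begin
      ∑[ u ∈ box n ] g u                                            ≡⟨ ∑-box n g ⟩
      ∑[ i ∈ range n ] ∑[ j ∈ range n ] g (i , j)                   ≤⟨ shift n _ row≤side ⟩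
      ∑[ i ∈ range n ] ∑[ j ∈ range n ] g (i ℤ.+ a , j) + side n * 1
        ≡⟨ cong₂ _+_ (∑-cong (range n) λ i → ∑-cong (range n) λ j → cong (λ t → g (i ℤ.+ a , t)) (sym (ℤP.+-identityʳ j)))
                     (ℕP.*-identityʳ (side n)) ⟩
      ∑[ i ∈ range n ] ∑[ j ∈ range n ] g ((i , j) ⊕ (a , + 0)) + side n ≡⟨ cong (_+ side n) (sym (∑-box n _)) ⟩
      ∑[ u ∈ box n ] g (u ⊕ (a , + 0)) + side n                     ∎

    ∑-box-shiftʸ : ∀ {a} → RangeShift a → ∑[ u ∈ box n ] g u ≤ ∑[ u ∈ box n ] g (u ⊕ (+ 0 , a)) + side n
    ∑-box-shiftʸ {a} shift = begin
      ∑[ u ∈ box n ] g u                                            ≡⟨ ∑-box n g ⟩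
      ∑[ i ∈ range n ] ∑[ j ∈ range n ] g (i , j)
        ≤⟨ ∑-mono (range n) (λ i → shift n (λ j → g (i , j)) (λ j → g≤1 (i , j))) ⟩
      ∑[ i ∈ range n ] (∑[ j ∈ range n ] g (i , j ℤ.+ a) + 1)
        ≡⟨ ∑-distrib-+ (range n) (λ i → ∑[ j ∈ range n ] g (i , j ℤ.+ a)) (λ _ → 1) ⟩
      ∑[ i ∈ range n ] ∑[ j ∈ range n ] g (i , j ℤ.+ a) + ∑[ i ∈ range n ] 1
        ≤⟨ ℕP.+-monoʳ-≤ _ (ℕP.≤-reflexive (trans (∑-range-const n 1) (ℕP.*-identityʳ (side n)))) ⟩
      ∑[ i ∈ range n ] ∑[ j ∈ range n ] g (i , j ℤ.+ a) + side n
        ≡⟨ cong (_+ side n) (∑-cong (range n) λ i → ∑-cong (range n) λ j → cong (λ t → g (t , j ℤ.+ a)) (sym (ℤP.+-identityʳ i))) ⟩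
      ∑[ i ∈ range n ] ∑[ j ∈ range n ] g ((i , j) ⊕ (+ 0 , a)) + side n ≡⟨ cong (_+ side n) (sym (∑-box n _)) ⟩
      ∑[ u ∈ box n ] g (u ⊕ (+ 0 , a)) + side n                     ∎

  ∑-box-shift : ∀ d → ∑[ u ∈ box n ] g u ≤ ∑[ u ∈ box n ] g (u ⊕ dir d) + side n
  ∑-box-shift east  = ∑-box-shiftˣ ∑-range-suc
  ∑-box-shift west  = ∑-box-shiftˣ ∑-range-pred
  ∑-box-shift north = ∑-box-shiftʸ ∑-range-suc
  ∑-box-shift south = ∑-box-shiftʸ ∑-range-pred

∑-box-one : ∀ n → ∑[ u ∈ box n ] 1 ≡ boxSize n
∑-box-one n = begin
  ∑[ u ∈ box n ] 1                   ≡⟨ ∑-box n (λ _ → 1) ⟩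
  ∑[ i ∈ range n ] ∑[ j ∈ range n ] 1 ≡⟨ ∑-cong (range n) (λ _ → trans (∑-range-const n 1) (ℕP.*-identityʳ (side n))) ⟩
  ∑[ i ∈ range n ] side n            ≡⟨ ∑-range-const n (side n) ⟩
  side n * side n                    ∎
  where open ≡-Reasoning

∑-dirs-opposite : ∀ (F : Dir → ℕ) → ∑[ d ∈ allDirs ] F (opposite d) ≡ ∑[ d ∈ allDirs ] F d
∑-dirs-opposite F = solve 4 (λ e w n s → w :+ (e :+ (s :+ (n :+ con 0))) := e :+ (w :+ (n :+ (s :+ con 0))))
                            refl (F east) (F west) (F north) (F south)
  where open ℕ-Solver

-- Each directed edge is counted once at its tail (left) and once at its head
-- (right); the two counts differ only across the boundary of the box, which
-- has at most side n edges in each direction.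
∑-box-edges : ∀ n (g : V → V → ℕ) → (∀ u w → g u w ≤ 1) →
              ∑[ u ∈ box n ] ∑[ d ∈ allDirs ] g u (u ⊕ dir d) ≤ ∑[ u ∈ box n ] ∑[ d ∈ allDirs ] g (u ⊕ dir d) u + 4 * side n
∑-box-edges n g g≤1 = begin
  ∑[ u ∈ box n ] ∑[ d ∈ allDirs ] g u (u ⊕ dir d)                              ≡⟨ ∑-comm (box n) allDirs (λ u d → g u (u ⊕ dir d)) ⟩
  ∑[ d ∈ allDirs ] ∑[ u ∈ box n ] g u (u ⊕ dir d)
    ≤⟨ ∑-mono allDirs (λ d → ∑-box-shift n (λ u → g u (u ⊕ dir d)) (λ u → g≤1 _ _) (opposite d)) ⟩
  ∑[ d ∈ allDirs ] (∑[ u ∈ box n ] g (u ⊕ dir (opposite d)) (u ⊕ dir (opposite d) ⊕ dir d) + side n)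
    ≡⟨ ∑-distrib-+ allDirs (λ d → ∑[ u ∈ box n ] g (u ⊕ dir (opposite d)) (u ⊕ dir (opposite d) ⊕ dir d)) (λ _ → side n) ⟩
  ∑[ d ∈ allDirs ] ∑[ u ∈ box n ] g (u ⊕ dir (opposite d)) (u ⊕ dir (opposite d) ⊕ dir d) + 4 * side n
    ≡⟨ cong (_+ 4 * side n) (∑-cong allDirs λ d → ∑-cong (box n) λ u → cong (g (u ⊕ dir (opposite d))) (back u d)) ⟩
  ∑[ d ∈ allDirs ] ∑[ u ∈ box n ] g (u ⊕ dir (opposite d)) u + 4 * side n
    ≡⟨ cong (_+ 4 * side n) (∑-dirs-opposite (λ d → ∑[ u ∈ box n ] g (u ⊕ dir d) u)) ⟩
  ∑[ d ∈ allDirs ] ∑[ u ∈ box n ] g (u ⊕ dir d) u + 4 * side n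
    ≡⟨ cong (_+ 4 * side n) (∑-comm allDirs (box n) (λ d u → g (u ⊕ dir d) u)) ⟩
  ∑[ u ∈ box n ] ∑[ d ∈ allDirs ] g (u ⊕ dir d) u + 4 * side n                 ∎
  where
  open ℕP.≤-Reasoning
  back : ∀ u d → u ⊕ dir (opposite d) ⊕ dir d ≡ u
  back u d = trans (⊕-assoc u _ _) (trans (cong (u ⊕_) (dir-opposite d)) (⊕-identityʳ u))

-- The lower bound

detectorNbrs : (V → Bool) → V → ℕ
detectorNbrs S u = ∑[ d ∈ allDirs ] indic (S (u ⊕ dir d))

crossing : (V → Bool) → V → V → ℕ
crossing S u w = indic (not (S u) ∧ S w)

module _ {S : V → Bool} (red : IsREDLD (toSet S)) where

  REDLD⇒two-detector-nbrs : ∀ {u} → ¬ T (S u) → 2 ≤ detectorNbrs S u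
  REDLD⇒two-detector-nbrs {u} ¬Su with proj₁ (proj₁ red) u ¬Su
  ... | w , u~w , Sw with proj₁ (proj₂ red w Sw) u (¬Su ∘ proj₁)
  ... | w′ , u~w′ , Sw′ , w′≢w with Adj⇒dir u w u~w | Adj⇒dir u w′ u~w′
  ... | d , refl | d′ , refl =
    2≤∑-indic (λ d → S (u ⊕ dir d)) (∈-allDirs d) (∈-allDirs d′) (λ { refl → w′≢w refl }) Sw Sw′

  REDLD⇒detector-nbr : ∀ {u} → T (S u) → 1 ≤ detectorNbrs S u
  REDLD⇒detector-nbr {u} Su with proj₁ (proj₂ red u Su) u (λ (_ , u≢u) → u≢u refl)
  ... | w , u~w , Sw , _ with Adj⇒dir u w u~w
  ... | d , refl = 1≤∑-indic (λ d → S (u ⊕ dir d)) (∈-allDirs d) Sw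

  nondetector-crossings : ∀ u → 2 * indic (not (S u)) ≤ ∑[ d ∈ allDirs ] crossing S u (u ⊕ dir d)
  nondetector-crossings u with S u in Su
  ... | true  = z≤n
  ... | false = REDLD⇒two-detector-nbrs (subst T Su)

  detector-crossings : ∀ u → ∑[ d ∈ allDirs ] crossing S (u ⊕ dir d) u ≤ 3 * indic (S u)
  detector-crossings u with S u in Su
  ... | false = ℕP.≤-reflexive (∑-cong allDirs (λ d → cong indic (∧-zeroʳ (not (S (u ⊕ dir d))))))
  ... | true  = begin
    ∑[ d ∈ allDirs ] indic (not (S (u ⊕ dir d)) ∧ true) ≡⟨ ∑-cong allDirs (λ d → cong indic (∧-identityʳ (not (S (u ⊕ dir d))))) ⟩
    nondetectors                                        ≤⟨ ℕP.+-cancelʳ-≤ 1 _ 3 nondetectors+1≤4 ⟩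
    3                                                   ∎
    where
    open ℕP.≤-Reasoning
    nondetectors = ∑[ d ∈ allDirs ] indic (not (S (u ⊕ dir d)))
    nondetectors+1≤4 : nondetectors + 1 ≤ 4
    nondetectors+1≤4 = begin
      nondetectors + 1                 ≤⟨ ℕP.+-monoʳ-≤ nondetectors (REDLD⇒detector-nbr (subst T (sym Su) tt)) ⟩
      nondetectors + detectorNbrs S u  ≡⟨ ∑-indic-not allDirs (λ d → S (u ⊕ dir d)) ⟩
      4                                ∎

  REDLD-box-count : ∀ n → 2 * boxSize n ≤ 5 * count S n + 4 * side n
  REDLD-box-count n = begin
    2 * boxSize n                       ≡⟨ cong (2 *_) (sym (trans (∑-indic-not (box n) S) (∑-box-one n))) ⟩
    2 * (nondetectors + count S n)      ≡⟨ ℕP.*-distribˡ-+ 2 nondetectors _ ⟩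
    2 * nondetectors + 2 * count S n    ≤⟨ ℕP.+-monoˡ-≤ _ 2nondetectors≤ ⟩
    3 * count S n + 4 * side n + 2 * count S n
      ≡⟨ solve 2 (λ s m → con 3 :* s :+ con 4 :* m :+ con 2 :* s := con 5 :* s :+ con 4 :* m) refl (count S n) (side n) ⟩
    5 * count S n + 4 * side n          ∎
    where
    open ℕP.≤-Reasoning
    open ℕ-Solver
    nondetectors = ∑[ u ∈ box n ] indic (not (S u))
    2nondetectors≤ : 2 * nondetectors ≤ 3 * count S n + 4 * side n
    2nondetectors≤ = begin
      2 * nondetectors                                          ≡⟨ *-distribˡ-∑ (box n) 2 (λ u → indic (not (S u))) ⟩
      ∑[ u ∈ box n ] (2 * indic (not (S u)))                    ≤⟨ ∑-mono (box n) nondetector-crossings ⟩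
      ∑[ u ∈ box n ] ∑[ d ∈ allDirs ] crossing S u (u ⊕ dir d)  ≤⟨ ∑-box-edges n (crossing S) (λ _ _ → indic≤1 _) ⟩
      ∑[ u ∈ box n ] ∑[ d ∈ allDirs ] crossing S (u ⊕ dir d) u + 4 * side n
        ≤⟨ ℕP.+-monoˡ-≤ _ (∑-mono (box n) detector-crossings) ⟩
      ∑[ u ∈ box n ] (3 * indic (S u)) + 4 * side n               ≡⟨ cong (_+ 4 * side n) (sym (*-distribˡ-∑ (box n) 3 (λ u → indic (S u)))) ⟩
      3 * count S n + 4 * side n                                ∎

-- The error term c · side n is absorbed once side n ≥ c · k.
DensityGE-from-box-count : ∀ S p q c .{{_ : NonZero q}} →
                           (∀ n → p * boxSize n ≤ q * count S n + c * side n) → DensityGE S p q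
DensityGE-from-box-count S p q c bound k _ N = N + c * k , ℕP.m≤m+n N (c * k) , scaled
  where
  open ℕP.≤-Reasoning
  open ℕ-Solver
  M = side (N + c * k)
  s = count S (N + c * k)
  scaled : p * k * (M * M) ≤ q * k * s + q * (M * M)
  scaled = begin
    p * k * (M * M)                 ≡⟨ solve 3 (λ p k x → p :* k :* x := k :* (p :* x)) refl p k (M * M) ⟩
    k * (p * (M * M))               ≤⟨ ℕP.*-monoʳ-≤ k (bound (N + c * k)) ⟩
    k * (q * s + c * M)             ≡⟨ solve 5 (λ k q s c m → k :* (q :* s :+ c :* m) := q :* k :* s :+ c :* k :* m) refl k q s c M ⟩
    q * k * s + c * k * M           ≤⟨ ℕP.+-monoʳ-≤ (q * k * s) (ℕP.*-monoˡ-≤ M (ℕP.≤-trans (ℕP.m≤n+m (c * k) N) (n≤side _))) ⟩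
    q * k * s + M * M               ≤⟨ ℕP.+-monoʳ-≤ (q * k * s) (ℕP.m≤n*m (M * M) q) ⟩
    q * k * s + q * (M * M)         ∎

DensityLE-from-box-count : ∀ S p q c .{{_ : NonZero q}} →
                           (∀ n → q * count S n ≤ p * boxSize n + c * side n) → DensityLE S p q
DensityLE-from-box-count S p q c bound k _ = c * k , scaled
  where
  open ℕP.≤-Reasoning
  open ℕ-Solver
  scaled : ∀ n → c * k ≤ n → q * k * count S n ≤ p * k * boxSize n + q * boxSize n
  scaled n ck≤n = begin
    q * k * s                       ≡⟨ solve 3 (λ q k s → q :* k :* s := k :* (q :* s)) refl q k s ⟩
    k * (q * s)                     ≤⟨ ℕP.*-monoʳ-≤ k (bound n) ⟩
    k * (p * (M * M) + c * M)       ≡⟨ solve 5 (λ k p x c m → k :* (p :* x :+ c :* m) := p :* k :* x :+ c :* k :* m) refl k p (M * M) c M ⟩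
    p * k * (M * M) + c * k * M     ≤⟨ ℕP.+-monoʳ-≤ (p * k * (M * M)) (ℕP.*-monoˡ-≤ M (ℕP.≤-trans ck≤n (n≤side n))) ⟩
    p * k * (M * M) + M * M         ≤⟨ ℕP.+-monoʳ-≤ (p * k * (M * M)) (ℕP.m≤n*m (M * M) q) ⟩
    p * k * (M * M) + q * (M * M)   ∎
    where
    M = side n
    s = count S n

-- A local criterion for RED:LD sets

adj : V → V → Bool
adj u w = ⌊ Adj? u w ⌋

units : List V
units = map dir allDirs

someBesides : (V → Bool) → List V → V → Bool
someBesides p os x = any (λ o → p o ∧ not ⌊ o ≟ᵥ x ⌋) os

-- Witnesses surviving the deletion of one vertex from S: when the deleted
-- vertex is known, one other witness suffices, otherwise two are needed.
robustWitness : (V → Bool) → List V → Maybe V → Bool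
robustWitness p os (just x) = someBesides p os x
robustWitness p os nothing  = any (λ o → p o ∧ someBesides p os o) os

-- In the checks below σ is S seen from a vertex u, i.e. σ o = S (u ⊕ o).
separates : (V → Bool) → V → V → Bool
separates σ δ o = σ o ∧ (adj origin o xor adj δ o)

candidates : V → List V
candidates δ = units ++ map (δ ⊕_) units

dominationCheck : (V → Bool) → Bool
dominationCheck σ = robustWitness (λ o → σ o ∧ adj origin o) units (findᵇ σ (origin ∷ []))

-- A detector among u and v = u ⊕ δ must be the deleted vertex; they cannot both be.
pairCheck : (V → Bool) → V → Bool
pairCheck σ δ = (σ origin ∧ σ δ) ∨ robustWitness (separates σ δ) (candidates δ) (findᵇ σ (origin ∷ δ ∷ []))

twoSteps : List V
twoSteps = cartesianProductWith (λ d d′ → dir d ⊕ dir d′) allDirs allDirs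

localCheck : (V → Bool) → Bool
localCheck σ = dominationCheck σ ∧ all (λ δ → ⌊ δ ≟ᵥ origin ⌋ ∨ pairCheck σ δ) twoSteps

-- The implicit arguments of T-∧ are given: inferring them would unfold localCheck.
localCheck-domination : ∀ σ → T (localCheck σ) → T (dominationCheck σ)
localCheck-domination σ = proj₁ ∘ Equivalence.to (T-∧ {dominationCheck σ} {all (λ δ → ⌊ δ ≟ᵥ origin ⌋ ∨ pairCheck σ δ) twoSteps})

localCheck-pair : ∀ σ {δ} → T (localCheck σ) → δ ∈ twoSteps → T (⌊ δ ≟ᵥ origin ⌋ ∨ pairCheck σ δ)
localCheck-pair σ ok = All.lookup (all⁺ (λ δ → ⌊ δ ≟ᵥ origin ⌋ ∨ pairCheck σ δ) twoSteps
  (proj₂ (Equivalence.to (T-∧ {dominationCheck σ} {all (λ δ → ⌊ δ ≟ᵥ origin ⌋ ∨ pairCheck σ δ) twoSteps}) ok)))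

xor-sound : ∀ {A B : Set} (a? : Dec A) (b? : Dec B) → T (⌊ a? ⌋ xor ⌊ b? ⌋) → (A × ¬ B) ⊎ (¬ A × B)
xor-sound (yes a) (no ¬b) _ = inj₁ (a , ¬b)
xor-sound (no ¬a) (yes b) _ = inj₂ (¬a , b)

someBesides-sound : ∀ p os x → T (someBesides p os x) → ∃ λ o → T (p o) × o ≢ x
someBesides-sound p os x h with satisfied (any⁻ _ os h)
... | o , h′ with Equivalence.to (T-∧ {p o}) h′
... | po , o≢x = o , po , toWitnessFalse o≢x

module _ (S : V → Bool) (view : V → V → Bool) (view-S : ∀ u o → view u o ≡ S (u ⊕ o))
         (locally : ∀ u → T (localCheck (view u)))
         (S′ : VSet) (S′? : ∀ w → Dec (S′ w))
         (one-deleted : ∀ a b → T (S a) → ¬ S′ a → T (S b) → ¬ S′ b → a ≡ b) where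

  private
    S-view : ∀ u {o} → T (view u o) → T (S (u ⊕ o))
    S-view u {o} = subst T (view-S u o)

    S-view₀ : ∀ u → T (view u origin) → T (S u)
    S-view₀ u = subst (T ∘ S) (⊕-identityʳ u) ∘ S-view u

    ¬S′-⊕₀ : ∀ {u} → ¬ S′ u → ¬ S′ (u ⊕ origin)
    ¬S′-⊕₀ {u} ¬S′u = ¬S′u ∘ subst S′ (⊕-identityʳ u)

    survivor : ∀ {a b} → T (S a) → T (S b) → a ≢ b → S′ a ⊎ S′ b
    survivor {a} {b} Sa Sb a≢b with S′? a | S′? b
    ... | yes S′a | _       = inj₁ S′a
    ... | no _    | yes S′b = inj₂ S′b
    ... | no ¬S′a | no ¬S′b = ⊥-elim (a≢b (one-deleted a b Sa ¬S′a Sb ¬S′b))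

    robustWitness-sound : ∀ u p os mx → (∀ {o} → T (p o) → T (S (u ⊕ o))) →
                   (∀ {x} → mx ≡ just x → T (S (u ⊕ x)) × ¬ S′ (u ⊕ x)) →
                   T (robustWitness p os mx) → ∃ λ o → T (p o) × S′ (u ⊕ o)
    robustWitness-sound u p os (just x) p⇒S deleted h with someBesides-sound p os x h
    ... | o , po , o≢x with survivor (proj₁ (deleted refl)) (p⇒S po) (o≢x ∘ sym ∘ ⊕-cancelˡ u)
    ... | inj₁ S′x = ⊥-elim (proj₂ (deleted refl) S′x)
    ... | inj₂ S′o = o , po , S′o
    robustWitness-sound u p os nothing p⇒S _ h with satisfied (any⁻ _ os h)
    ... | o , h′ with Equivalence.to (T-∧ {p o}) h′
    ... | po , h″ with someBesides-sound p os o h″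
    ... | o′ , po′ , o′≢o with survivor (p⇒S po) (p⇒S po′) (o′≢o ∘ sym ∘ ⊕-cancelˡ u)
    ... | inj₁ S′o  = o , po , S′o
    ... | inj₂ S′o′ = o′ , po′ , S′o′

    findᵇ-sound : ∀ u xs → All (λ x → ¬ S′ (u ⊕ x)) xs →
                      ∀ {x} → findᵇ (view u) xs ≡ just x → T (S (u ⊕ x)) × ¬ S′ (u ⊕ x)
    findᵇ-sound u (y ∷ ys) (¬S′y ∷ ¬S′ys) eq with view u y in vy
    findᵇ-sound u (y ∷ ys) (¬S′y ∷ ¬S′ys) refl | true = S-view u (subst T (sym vy) tt) , ¬S′y
    ... | false = findᵇ-sound u ys ¬S′ys eq

    dominated : ∀ u → ¬ S′ u → ∃ λ w → InNbrS S′ u w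
    dominated u ¬S′u
      with robustWitness-sound u (λ o → view u o ∧ adj origin o) units (findᵇ (view u) (origin ∷ []))
             (λ {o} h → S-view u (proj₁ (Equivalence.to (T-∧ {view u o}) h)))
             (findᵇ-sound u (origin ∷ []) (¬S′-⊕₀ ¬S′u ∷ []))
             (localCheck-domination (view u) (locally u))
    ... | o , h , S′o = u ⊕ o , Adj-from-origin u (toWitness (proj₂ (Equivalence.to (T-∧ {view u o}) h))) , S′o

    separated : ∀ u δ o → T (separates (view u) δ o) → S′ (u ⊕ o) →
                ¬ (∀ w → InNbrS S′ u w ⇔ InNbrS S′ (u ⊕ δ) w)
    separated u δ o sep S′o same with xor-sound (Adj? origin o) (Adj? δ o) (proj₂ (Equivalence.to (T-∧ {view u o}) sep))
    ... | inj₁ (0~o , ¬δ~o) = ¬δ~o (Adj-⊕⁻ u (proj₁ (Equivalence.to (same (u ⊕ o)) (Adj-from-origin u 0~o , S′o))))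
    ... | inj₂ (¬0~o , δ~o) = ¬0~o (Adj-⊕⁻ u (subst (λ x → Adj x (u ⊕ o)) (sym (⊕-identityʳ u))
                                       (proj₁ (Equivalence.from (same (u ⊕ o)) (Adj-⊕⁺ u δ~o , S′o)))))

    pair-distinguished : ∀ u v δ → v ≡ u ⊕ δ → ¬ S′ u → ¬ S′ v → u ≢ v →
                         T (⌊ δ ≟ᵥ origin ⌋ ∨ pairCheck (view u) δ) → ¬ (∀ w → InNbrS S′ u w ⇔ InNbrS S′ v w)
    pair-distinguished u _ δ refl ¬S′u ¬S′v u≢v h same with Equivalence.to (T-∨ {⌊ δ ≟ᵥ origin ⌋}) h
    ... | inj₁ δ≡0 = u≢v (sym (trans (cong (u ⊕_) (toWitness δ≡0)) (⊕-identityʳ u)))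
    ... | inj₂ h′ with Equivalence.to (T-∨ {view u origin ∧ view u δ}) h′
    ... | inj₁ both = let S0 , Sδ = Equivalence.to (T-∧ {view u origin}) both in
                      u≢v (one-deleted u (u ⊕ δ) (S-view₀ u S0) ¬S′u (S-view u Sδ) ¬S′v)
    ... | inj₂ r with robustWitness-sound u (separates (view u) δ) (candidates δ) (findᵇ (view u) (origin ∷ δ ∷ []))
                        (λ {o} sep → S-view u (proj₁ (Equivalence.to (T-∧ {view u o}) sep)))
                        (findᵇ-sound u (origin ∷ δ ∷ []) (¬S′-⊕₀ ¬S′u ∷ ¬S′v ∷ [])) r
    ... | o , sep , S′o = separated u δ o sep S′o same

    -- A dominator of u is adjacent to v as well, so v lies at a two-step offset from u.
    distinguished : ∀ u v → ¬ S′ u → ¬ S′ v → u ≢ v → ¬ (∀ w → InNbrS S′ u w ⇔ InNbrS S′ v w)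
    distinguished u v ¬S′u ¬S′v u≢v same =
      let w , u~w , S′w = dominated u ¬S′u
          d , w≡u⊕d = Adj⇒dir u w u~w
          d′ , v≡w⊕d′ = Adj⇒dir w v (Adj-sym v w (proj₁ (Equivalence.to (same w) (u~w , S′w))))
      in pair-distinguished u v (dir d ⊕ dir d′)
           (trans v≡w⊕d′ (trans (cong (_⊕ dir d′) w≡u⊕d) (⊕-assoc u (dir d) (dir d′)))) ¬S′u ¬S′v u≢v
           (localCheck-pair (view u) (locally u) (∈-cartesianProductWith⁺ (λ d d′ → dir d ⊕ dir d′) (∈-allDirs d) (∈-allDirs d′)))
           same

  LD-of-local : IsLD S′
  LD-of-local = dominated , distinguished

REDLD-of-local : ∀ S (view : V → V → Bool) → (∀ u o → view u o ≡ S (u ⊕ o)) →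
                 (∀ u → T (localCheck (view u))) → IsREDLD (toSet S)
REDLD-of-local S view view-S locally =
  LD-of-local S view view-S locally (toSet S) (T? ∘ S) (λ _ _ Sa ¬Sa _ _ → ⊥-elim (¬Sa Sa)) ,
  λ v _ → LD-of-local S view view-S locally (remove (toSet S) v) (λ w → T? (S w) ×-dec ¬? (w ≟ᵥ v))
            (λ a b Sa ¬S′a Sb ¬S′b → trans (deleted Sa ¬S′a) (sym (deleted Sb ¬S′b)))
  where
  deleted : ∀ {v a} → T (S a) → ¬ remove (toSet S) v a → a ≡ v
  deleted {v} {a} Sa ¬S′a with a ≟ᵥ v
  ... | yes a≡v = a≡v
  ... | no  a≢v = ⊥-elim (¬S′a (Sa , a≢v))

record Cycle : Set₁ where
  field
    Carrier   : Set
    next prev : Carrier → Carrier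
    next-prev : ∀ c → next (prev c) ≡ c
    prev-next : ∀ c → prev (next c) ≡ c

  next^ prev^ : ℕ → Carrier → Carrier
  next^ zero    c = c
  next^ (suc k) c = next (next^ k c)
  prev^ zero    c = c
  prev^ (suc k) c = prev (prev^ k c)

  act : ℤ → Carrier → Carrier
  act (+ k)      c = next^ k c
  act -[1+ k ]   c = prev^ (suc k) c

  act-suc : ∀ x c → act (x ℤ.+ + 1) c ≡ next (act x c)
  act-suc (+ k)          c rewrite ℕP.+-comm k 1 = refl
  act-suc -[1+ zero ]    c = sym (next-prev c)
  act-suc -[1+ suc k ]   c = sym (next-prev _)

  act-pred : ∀ x c → act (x ℤ.+ -[1+ 0 ]) c ≡ prev (act x c)
  act-pred x c = begin
    act (x ℤ.+ -[1+ 0 ]) c                     ≡⟨ sym (prev-next _) ⟩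
    prev (next (act (x ℤ.+ -[1+ 0 ]) c))       ≡⟨ cong prev (sym (act-suc (x ℤ.+ -[1+ 0 ]) c)) ⟩
    prev (act (x ℤ.+ -[1+ 0 ] ℤ.+ + 1) c)      ≡⟨ cong (λ y → prev (act y c)) (trans (ℤP.+-assoc x -[1+ 0 ] (+ 1)) (ℤP.+-identityʳ x)) ⟩
    prev (act x c)                             ∎
    where open ≡-Reasoning

  act-+ : ∀ x a c → act (x ℤ.+ a) c ≡ act a (act x c)
  act-+ x (+ zero)       c = cong (λ y → act y c) (ℤP.+-identityʳ x)
  act-+ x (+ suc k)      c = begin
    act (x ℤ.+ + suc k) c          ≡⟨ cong (λ y → act y c) (trans (cong (λ t → x ℤ.+ + t) (ℕP.+-comm 1 k))
                                                                   (sym (ℤP.+-assoc x (+ k) (+ 1)))) ⟩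
    act (x ℤ.+ + k ℤ.+ + 1) c      ≡⟨ act-suc (x ℤ.+ + k) c ⟩
    next (act (x ℤ.+ + k) c)       ≡⟨ cong next (act-+ x (+ k) c) ⟩
    next (next^ k (act x c))       ∎
    where open ≡-Reasoning
  act-+ x -[1+ zero ]    c = act-pred x c
  act-+ x -[1+ suc k ]   c = begin
    act (x ℤ.+ -[1+ suc k ]) c               ≡⟨ cong (λ y → act y c) (trans (cong (λ t → x ℤ.+ -[1+ suc t ]) (sym (ℕP.+-identityʳ k)))
                                                                               (sym (ℤP.+-assoc x -[1+ k ] -[1+ 0 ]))) ⟩
    act (x ℤ.+ -[1+ k ] ℤ.+ -[1+ 0 ]) c      ≡⟨ act-pred (x ℤ.+ -[1+ k ]) c ⟩
    prev (act (x ℤ.+ -[1+ k ]) c)            ≡⟨ cong prev (act-+ x -[1+ k ] c) ⟩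
    prev (prev^ (suc k) (act x c))           ∎
    where open ≡-Reasoning

  next^-+ : ∀ m k c → next^ (m + k) c ≡ next^ k (next^ m c)
  next^-+ m zero    c = cong (λ t → next^ t c) (ℕP.+-identityʳ m)
  next^-+ m (suc k) c = trans (cong (λ t → next^ t c) (ℕP.+-suc m k)) (cong next (next^-+ m k c))

  ∑-range-orbit : ∀ p .{{_ : NonZero p}} {W b} (g : Carrier → ℕ) → (∀ x → g x ≤ b) →
                  (∀ c → ∑< p (λ k → g (next^ k c)) ≡ W) →
                  ∀ n c → p * ∑[ x ∈ range n ] g (act x c) ≤ side n * W + p * p * b
  ∑-range-orbit p {W} {b} g g≤b period n c =
    subst (λ t → p * t ≤ side n * W + p * p * b) (sym (trans (∑-range n (λ x → g (act x c))) (∑<-cong (side n) along-orbit)))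
          (∑<-periodic p (λ k → g (next^ k c₀)) (λ k → g≤b (next^ k c₀))
                       (λ m → trans (∑<-cong p (λ k → cong g (next^-+ m k c₀))) (period _)) (side n))
    where
    c₀ = act (ℤ.- + n) c
    along-orbit : ∀ k → g (act (+ k ℤ.- + n) c) ≡ g (next^ k c₀)
    along-orbit k = cong g (trans (cong (λ y → act y c) (ℤP.+-comm (+ k) (ℤ.- + n))) (act-+ (ℤ.- + n) (+ k) c))

-- The upper bound: a tile of 14 detectors in a 4 × 8 period

data Z₄ : Set where
  0₄ 1₄ 2₄ 3₄ : Z₄

data Z₈ : Set where
  0₈ 1₈ 2₈ 3₈ 4₈ 5₈ 6₈ 7₈ : Z₈

cycle₄ : Cycle
cycle₄ = record { Carrier = Z₄ ; next = next ; prev = prev ; next-prev = next-prev ; prev-next = prev-next }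
  where
  next prev : Z₄ → Z₄
  next 0₄ = 1₄
  next 1₄ = 2₄
  next 2₄ = 3₄
  next 3₄ = 0₄
  prev 0₄ = 3₄
  prev 1₄ = 0₄
  prev 2₄ = 1₄
  prev 3₄ = 2₄
  next-prev : ∀ c → next (prev c) ≡ c
  next-prev 0₄ = refl
  next-prev 1₄ = refl
  next-prev 2₄ = refl
  next-prev 3₄ = refl
  prev-next : ∀ c → prev (next c) ≡ c
  prev-next 0₄ = refl
  prev-next 1₄ = refl
  prev-next 2₄ = refl
  prev-next 3₄ = refl

cycle₈ : Cycle
cycle₈ = record { Carrier = Z₈ ; next = next ; prev = prev ; next-prev = next-prev ; prev-next = prev-next }
  where
  next prev : Z₈ → Z₈
  next 0₈ = 1₈
  next 1₈ = 2₈
  next 2₈ = 3₈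
  next 3₈ = 4₈
  next 4₈ = 5₈
  next 5₈ = 6₈
  next 6₈ = 7₈
  next 7₈ = 0₈
  prev 0₈ = 7₈
  prev 1₈ = 0₈
  prev 2₈ = 1₈
  prev 3₈ = 2₈
  prev 4₈ = 3₈
  prev 5₈ = 4₈
  prev 6₈ = 5₈
  prev 7₈ = 6₈
  next-prev : ∀ c → next (prev c) ≡ c
  next-prev 0₈ = refl
  next-prev 1₈ = refl
  next-prev 2₈ = refl
  next-prev 3₈ = refl
  next-prev 4₈ = refl
  next-prev 5₈ = refl
  next-prev 6₈ = refl
  next-prev 7₈ = refl
  prev-next : ∀ c → prev (next c) ≡ c
  prev-next 0₈ = refl
  prev-next 1₈ = refl
  prev-next 2₈ = refl
  prev-next 3₈ = refl
  prev-next 4₈ = refl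
  prev-next 5₈ = refl
  prev-next 6₈ = refl
  prev-next 7₈ = refl

module C₄ = Cycle cycle₄
module C₈ = Cycle cycle₈

tile : Z₄ → Z₈ → Bool
tile 0₄ = λ { 0₈ → true  ; 1₈ → true  ; 2₈ → false ; 3₈ → true  ; 4₈ → true  ; 5₈ → false ; 6₈ → true  ; 7₈ → false }
tile 1₄ = λ { 0₈ → false ; 1₈ → false ; 2₈ → true  ; 3₈ → false ; 4₈ → false ; 5₈ → false ; 6₈ → true  ; 7₈ → false }
tile 2₄ = λ { 0₈ → true  ; 1₈ → false ; 2₈ → true  ; 3₈ → false ; 4₈ → true  ; 5₈ → true  ; 6₈ → false ; 7₈ → true  }
tile 3₄ = λ { 0₈ → false ; 1₈ → false ; 2₈ → true  ; 3₈ → false ; 4₈ → false ; 5₈ → false ; 6₈ → true  ; 7₈ → false }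

Residue : Set
Residue = Z₄ × Z₈

residueView : Residue → V → Bool
residueView (r , c) (a , b) = tile (C₄.act a r) (C₈.act b c)

tiling : V → Bool
tiling = residueView (0₄ , 0₈)

residue : V → Residue
residue (i , j) = (C₄.act i 0₄ , C₈.act j 0₈)

residueView-tiling : ∀ u o → residueView (residue u) o ≡ tiling (u ⊕ o)
residueView-tiling (i , j) (a , b) = sym (cong₂ tile (C₄.act-+ i a 0₄) (C₈.act-+ j b 0₈))

allResidues : List Residue
allResidues = cartesianProductWith _,_ (0₄ ∷ 1₄ ∷ 2₄ ∷ 3₄ ∷ []) (0₈ ∷ 1₈ ∷ 2₈ ∷ 3₈ ∷ 4₈ ∷ 5₈ ∷ 6₈ ∷ 7₈ ∷ [])

decide-residues : ∀ (p : Residue → Bool) → T (all p allResidues) → ∀ r → T (p r)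
decide-residues p checked (r , c) = All.lookup (all⁺ p allResidues checked) (∈-cartesianProductWith⁺ _,_ (∈-Z₄ r) (∈-Z₈ c))
  where
  ∈-Z₄ : ∀ r → r ∈ 0₄ ∷ 1₄ ∷ 2₄ ∷ 3₄ ∷ []
  ∈-Z₄ 0₄ = here refl
  ∈-Z₄ 1₄ = there (here refl)
  ∈-Z₄ 2₄ = there (there (here refl))
  ∈-Z₄ 3₄ = there (there (there (here refl)))
  ∈-Z₈ : ∀ c → c ∈ 0₈ ∷ 1₈ ∷ 2₈ ∷ 3₈ ∷ 4₈ ∷ 5₈ ∷ 6₈ ∷ 7₈ ∷ []
  ∈-Z₈ 0₈ = here refl
  ∈-Z₈ 1₈ = there (here refl)
  ∈-Z₈ 2₈ = there (there (here refl))
  ∈-Z₈ 3₈ = there (there (there (here refl)))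
  ∈-Z₈ 4₈ = there (there (there (there (here refl))))
  ∈-Z₈ 5₈ = there (there (there (there (there (here refl)))))
  ∈-Z₈ 6₈ = there (there (there (there (there (there (here refl))))))
  ∈-Z₈ 7₈ = there (there (there (there (there (there (there (here refl)))))))

tiling-REDLD : IsREDLD (toSet tiling)
tiling-REDLD = REDLD-of-local tiling (residueView ∘ residue) residueView-tiling
                 (λ u → decide-residues (localCheck ∘ residueView) tt (residue u))

rowWeight : Z₄ → ℕ
rowWeight r = ∑< 8 (λ k → indic (tile r (C₈.next^ k 0₈)))

rowWeight-window : ∀ r c → ∑< 8 (λ k → indic (tile r (C₈.next^ k c))) ≡ rowWeight r
rowWeight-window r c =
  ℕP.≡ᵇ⇒≡ _ _ (decide-residues (λ (r , c) → ∑< 8 (λ k → indic (tile r (C₈.next^ k c))) ℕ.≡ᵇ rowWeight r) tt (r , c))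

rowWeight-column : ∀ r → ∑< 4 (λ k → rowWeight (C₄.next^ k r)) ≡ 14
rowWeight-column 0₄ = refl
rowWeight-column 1₄ = refl
rowWeight-column 2₄ = refl
rowWeight-column 3₄ = refl

tiling-box-count : ∀ n → 16 * count tiling n ≤ 7 * boxSize n + 192 * side n
tiling-box-count n = ℕP.*-cancelˡ-≤ 2 (begin
  2 * (16 * count tiling n)              ≡⟨ cong (λ t → 2 * (16 * t)) (∑-box n (λ u → indic (tiling u))) ⟩
  2 * (16 * rows)                        ≡⟨ solve 1 (λ s → con 2 :* (con 16 :* s) := con 4 :* (con 8 :* s)) refl rows ⟩
  4 * (8 * rows)                         ≡⟨ cong (4 *_) (*-distribˡ-∑ (range n) 8 row) ⟩
  4 * ∑[ i ∈ range n ] (8 * row i)       ≤⟨ ℕP.*-monoʳ-≤ 4 (∑-mono (range n) row-bound) ⟩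
  4 * ∑[ i ∈ range n ] (M * weight i + 64)
    ≡⟨ cong (4 *_) (trans (∑-distrib-+ (range n) (λ i → M * weight i) (λ _ → 64))
                          (cong₂ _+_ (sym (*-distribˡ-∑ (range n) M weight)) (∑-range-const n 64))) ⟩
  4 * (M * weights + M * 64)
    ≡⟨ solve 2 (λ m w → con 4 :* (m :* w :+ m :* con 64) := m :* (con 4 :* w) :+ con 256 :* m) refl M weights ⟩
  M * (4 * weights) + 256 * M            ≤⟨ ℕP.+-monoˡ-≤ (256 * M) (ℕP.*-monoʳ-≤ M column-bound) ⟩
  M * (M * 14 + 128) + 256 * M
    ≡⟨ solve 1 (λ m → m :* (m :* con 14 :+ con 128) :+ con 256 :* m := con 2 :* (con 7 :* (m :* m) :+ con 192 :* m)) refl M ⟩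
  2 * (7 * (M * M) + 192 * M)            ∎)
  where
  open ℕP.≤-Reasoning
  open ℕ-Solver
  M = side n
  weight row : ℤ → ℕ
  weight i = rowWeight (C₄.act i 0₄)
  row i = ∑[ j ∈ range n ] indic (tiling (i , j))
  rows weights : ℕ
  rows = ∑[ i ∈ range n ] row i
  weights = ∑[ i ∈ range n ] weight i
  row-bound : ∀ i → 8 * row i ≤ M * weight i + 64
  row-bound i = C₈.∑-range-orbit 8 (λ c → indic (tile (C₄.act i 0₄) c)) (λ c → indic≤1 (tile (C₄.act i 0₄) c))
                                 (rowWeight-window (C₄.act i 0₄)) n 0₈
  column-bound : 4 * weights ≤ M * 14 + 128
  column-bound = C₄.∑-range-orbit 4 rowWeight (λ r → ∑<-bound 8 _ (λ k → indic≤1 (tile r (C₈.next^ k 0₈))))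
                                  rowWeight-column n 0₄

theorem20 : ((S : V → Bool) → IsREDLD (toSet S) → DensityGE S 2 5)
    × Σ (V → Bool) (λ S → IsREDLD (toSet S) × DensityLE S 7 16)
theorem20 = (λ S red → DensityGE-from-box-count S 2 5 4 (REDLD-box-count red))
          , tiling , tiling-REDLD , DensityLE-from-box-count tiling 7 16 192 tiling-box-count
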